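{- Let $X\subseteq\mathbb{R}^d$ be a point set and $x\in\mathbb{R}^d$. Then $x\in\mathrm{sconv}(X)$ if and only if for every $j=0,1,\dots,d$, the set $X$ contains a point of type $j$ with respect to $x$.
   Context: Stair-path $\sigma(a,b)$ for $a,b\in\mathbb{R}^d$: for $d=1$ the segment $ab$; for $d\ge 2$, assuming $a_d\le b_d$ (else swap), with $a'=(a_1,\dots,a_{d-1},b_d)$, $\sigma(a,b)$ is the union of segment $aa'$ and the stair-path $\sigma(a',b)$ defined recursively on the first $d-1$ coordinates. A set is stair-convex if it contains $\sigma(a,b)$ for any two of its points $a,b$. The stair-convex hull $\mathrm{sconv}(X)$ is the intersection of all stair-convex sets containing $X$. Types: for $a=(a_1,\dots,a_d)$, a point $b$ has type $0$ with respect to $a$ if $b_i\le a_i$ for all $i=1,\dots,d$; for $j\in\{1,\dots,d\}$, $b$ has type $j$ with respect to $a$ if $b_j\ge a_j$ and $b_i\le a_i$ for all $i=j+1,\dots,d$. (A point may have several types.) -}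

module Defs where

open import Level using (0ℓ)
open import Data.Nat using (ℕ; zero; suc)
open import Data.Fin using (Fin; zero; suc; inject₁; fromℕ; _<_)
open import Data.Product using (_×_; Σ; ∃)
open import Data.Sum using (_⊎_)
open import Relation.Binary.PropositionalEquality using (_≡_)
open import Relation.Unary using (Pred; _∈_; _⊆_)

-- Points of the d-dimensional space over a coordinate type A are functions
-- Fin d → A; coordinate i (0-based) corresponds to coordinate i+1 of the paper.
Point : Set → ℕ → Set
Point A d = Fin d → A

init : {A : Set} {d : ℕ} → Point A (suc d) → Point A d
init p i = p (inject₁ i)

last : {A : Set} {d : ℕ} → Point A (suc d) → A
last {d = d} p = p (fromℕ d)

module _ {A : Set} (_≤_ : A → A → Set) where

  mutual
    -- StairPath d a b y  :  y ∈ σ(a,b)  in dimension (suc d).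
    StairPath : (d : ℕ) → Point A (suc d) → Point A (suc d) → Point A (suc d) → Set
    StairPath zero a b y =
      (a zero ≤ y zero × y zero ≤ b zero) ⊎ (b zero ≤ y zero × y zero ≤ a zero)
    StairPath (suc d) a b y =
      (last a ≤ last b × StairUp d a b y) ⊎ (last b ≤ last a × StairUp d b a y)

    -- for a_d ≤ b_d, with a' = (a_1,…,a_{d-1},b_d):  segment aa'  ∪  σ(a',b)
    -- (σ(a',b) is the stair-path on the first d-1 coordinates, last coordinate b_d)
    StairUp : (d : ℕ) → Point A (suc (suc d)) → Point A (suc (suc d)) → Point A (suc (suc d)) → Set
    StairUp d a b y =
      ((∀ i → init y i ≡ init a i) × last a ≤ last y × last y ≤ last b)
      ⊎ (last y ≡ last b × StairPath d (init a) (init b) (init y))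

  StairConvex : {d : ℕ} → Pred (Point A (suc d)) 0ℓ → Set
  StairConvex {d} S = ∀ a b → a ∈ S → b ∈ S → ∀ y → StairPath d a b y → y ∈ S

  sconv : {d : ℕ} → Pred (Point A (suc d)) 0ℓ → Pred (Point A (suc d)) (Level.suc 0ℓ)
  sconv {d} X x = (S : Pred (Point A (suc d)) 0ℓ) → StairConvex S → X ⊆ S → x ∈ S

  -- HasType b a j : b has type j with respect to a, j ∈ {0,…,d}.
  -- j = zero is type 0; j = suc k is type k+1 (coordinate index k, 0-based).
  HasType : {d : ℕ} → Point A d → Point A d → Fin (suc d) → Set
  HasType b a zero = ∀ i → b i ≤ a i
  HasType b a (suc k) = (a k ≤ b k) × (∀ i → k < i → b i ≤ a i)

module Submission where

open import Defs
open import Data.Nat using (ℕ; zero; suc) renaming (_<_ to _<ℕ_)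
import Data.Nat.Properties as ℕ
open import Data.Fin using (Fin; zero; suc; inject₁; fromℕ; toℕ; _<_)
open import Data.Fin.Properties using (toℕ-inject₁; toℕ-fromℕ; inject₁ℕ<; ≤fromℕ)
open import Data.Fin.Relation.Unary.Top using (view; ‵fromℕ; ‵inject₁)
open import Data.Product using (_×_; _,_; proj₁; ∃)
open import Data.Sum using (inj₁; inj₂)
open import Data.Empty using (⊥-elim)
open import Function using (_∘_)
open import Function.Bundles using (_⇔_; mk⇔)
open import Relation.Nullary using (¬_)
open import Relation.Binary.PropositionalEquality
  using (_≡_; _≗_; refl; sym; trans; subst; subst₂)
open import Relation.Binary.Structures using (IsPreorder; IsTotalOrder)
open import Relation.Unary using (Pred; _∈_; _⊆_)
open import Level using (0ℓ)

-- The set of points with respect to which X has points of every type is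
-- stair-convex and contains X; this gives one inclusion.  For the other,
-- induct on the dimension: let S ⊇ X be stair-convex and q ∈ X of the top type
-- with respect to x, so q_d ≥ x_d =: c.  For every p ∈ X with p_d ≤ c the point
-- (p_1,…,p_{d-1},c) lies on the vertical leg of σ(p,q), hence in S.  So the
-- horizontal slice of S at height c is a stair-convex set containing the
-- projections of these points, and the projection of x has points of every
-- type among them.

inject₁-cancel-< : ∀ {n} {i j : Fin n} → inject₁ i < inject₁ j → i < j
inject₁-cancel-< {i = i} {j} = subst₂ _<ℕ_ (toℕ-inject₁ i) (toℕ-inject₁ j)

inject₁-mono-< : ∀ {n} {i j : Fin n} → i < j → inject₁ i < inject₁ j
inject₁-mono-< {i = i} {j} = subst₂ _<ℕ_ (sym (toℕ-inject₁ i)) (sym (toℕ-inject₁ j))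

inject₁<fromℕ : ∀ {n} (i : Fin n) → inject₁ i < fromℕ n
inject₁<fromℕ {n} i = subst (toℕ (inject₁ i) <ℕ_) (sym (toℕ-fromℕ n)) (inject₁ℕ< i)

fromℕ≮ : ∀ {n} (i : Fin (suc n)) → ¬ fromℕ n < i
fromℕ≮ i = ℕ.≤⇒≯ (≤fromℕ i)

_∷ʳ_ : ∀ {A : Set} {n} → Point A n → A → Point A (suc n)
_∷ʳ_ {n = zero}  w c zero    = c
_∷ʳ_ {n = suc n} w c zero    = w zero
_∷ʳ_ {n = suc n} w c (suc i) = ((λ j → w (suc j)) ∷ʳ c) i

init-∷ʳ : ∀ {A : Set} {n} (w : Point A n) (c : A) → init (w ∷ʳ c) ≗ w
init-∷ʳ {n = suc n} w c zero    = refl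
init-∷ʳ {n = suc n} w c (suc i) = init-∷ʳ (λ j → w (suc j)) c i

last-∷ʳ : ∀ {A : Set} {n} (w : Point A n) (c : A) → last (w ∷ʳ c) ≡ c
last-∷ʳ {n = zero}  w c = refl
last-∷ʳ {n = suc n} w c = last-∷ʳ (λ j → w (suc j)) c

module StairConvexity {A : Set} {_≤_ : A → A → Set} (isPreorder : IsPreorder _≡_ _≤_) where

  open IsPreorder isPreorder using () renaming (refl to ≤-refl; trans to ≤-trans)

  ≤-cong : ∀ {a b a′ b′} → a ≡ a′ → b ≡ b′ → a ≤ b → a′ ≤ b′
  ≤-cong = subst₂ _≤_

  mutual
    stairPath-cong : ∀ d {a b y a′ b′ y′ : Point A (suc d)} → a ≗ a′ → b ≗ b′ → y ≗ y′ →
                     StairPath _≤_ d a b y → StairPath _≤_ d a′ b′ y′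
    stairPath-cong zero a≗ b≗ y≗ (inj₁ (a≤y , y≤b)) =
      inj₁ (≤-cong (a≗ zero) (y≗ zero) a≤y , ≤-cong (y≗ zero) (b≗ zero) y≤b)
    stairPath-cong zero a≗ b≗ y≗ (inj₂ (b≤y , y≤a)) =
      inj₂ (≤-cong (b≗ zero) (y≗ zero) b≤y , ≤-cong (y≗ zero) (a≗ zero) y≤a)
    stairPath-cong (suc d) a≗ b≗ y≗ (inj₁ (a≤b , up)) =
      inj₁ (≤-cong (a≗ _) (b≗ _) a≤b , stairUp-cong d a≗ b≗ y≗ up)
    stairPath-cong (suc d) a≗ b≗ y≗ (inj₂ (b≤a , up)) =
      inj₂ (≤-cong (b≗ _) (a≗ _) b≤a , stairUp-cong d b≗ a≗ y≗ up)

    stairUp-cong : ∀ d {a b y a′ b′ y′ : Point A (suc (suc d))} → a ≗ a′ → b ≗ b′ → y ≗ y′ →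
                   StairUp _≤_ d a b y → StairUp _≤_ d a′ b′ y′
    stairUp-cong d a≗ b≗ y≗ (inj₁ (y≗a , a≤y , y≤b)) =
      inj₁ ( (λ i → trans (sym (y≗ (inject₁ i))) (trans (y≗a i) (a≗ (inject₁ i))))
           , ≤-cong (a≗ _) (y≗ _) a≤y , ≤-cong (y≗ _) (b≗ _) y≤b)
    stairUp-cong d a≗ b≗ y≗ (inj₂ (y≡b , path)) =
      inj₂ ( trans (sym (y≗ _)) (trans y≡b (b≗ _))
           , stairPath-cong d (a≗ ∘ inject₁) (b≗ ∘ inject₁) (y≗ ∘ inject₁) path)

  hasType-refl : ∀ {n} (p : Point A n) j → HasType _≤_ p p j
  hasType-refl p zero    i = ≤-refl
  hasType-refl p (suc k)   = ≤-refl , λ _ _ → ≤-refl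

  hasType-cong : ∀ {n} {p z w : Point A n} j → z ≗ w → HasType _≤_ p z j → HasType _≤_ p w j
  hasType-cong zero    z≗w p≤z i = ≤-cong refl (z≗w i) (p≤z i)
  hasType-cong (suc k) z≗w (z≤p , p≤z) =
    ≤-cong (z≗w k) refl z≤p , λ i k<i → ≤-cong refl (z≗w i) (p≤z i k<i)

  hasType-inject₁⁻ : ∀ {n} {p z : Point A (suc n)} j → HasType _≤_ p z (inject₁ j) →
                     last p ≤ last z × HasType _≤_ (init p) (init z) j
  hasType-inject₁⁻ {n} zero    p≤z = p≤z (fromℕ n) , p≤z ∘ inject₁
  hasType-inject₁⁻ {n} (suc k) (z≤p , p≤z) =
    p≤z (fromℕ n) (inject₁<fromℕ k) , z≤p , λ i k<i → p≤z (inject₁ i) (inject₁-mono-< k<i)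

  hasType-inject₁ : ∀ {n} {p z : Point A (suc n)} j → last p ≤ last z →
                    HasType _≤_ (init p) (init z) j → HasType _≤_ p z (inject₁ j)
  hasType-inject₁ zero p≤z init-p≤z i with view i
  ... | ‵fromℕ      = p≤z
  ... | ‵inject₁ i′ = init-p≤z i′
  hasType-inject₁ (suc k) p≤z (z≤p , init-p≤z) = z≤p , above
    where
      above : ∀ i → inject₁ k < i → _
      above i k<i with view i
      ... | ‵fromℕ      = p≤z
      ... | ‵inject₁ i′ = init-p≤z i′ (inject₁-cancel-< k<i)

  hasType-fromℕ⁻ : ∀ {n} {p z : Point A (suc n)} → HasType _≤_ p z (fromℕ (suc n)) → last z ≤ last p
  hasType-fromℕ⁻ = proj₁

  hasType-fromℕ : ∀ {n} {p z : Point A (suc n)} → last z ≤ last p → HasType _≤_ p z (fromℕ (suc n))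
  hasType-fromℕ z≤p = z≤p , λ i above-top → ⊥-elim (fromℕ≮ i above-top)

  AllTypes : ∀ {n} → Pred (Point A n) 0ℓ → Pred (Point A n) 0ℓ
  AllTypes {n} X z = (j : Fin (suc n)) → ∃ λ y → y ∈ X × HasType _≤_ y z j

  ⊆-allTypes : ∀ {n} (X : Pred (Point A n) 0ℓ) → X ⊆ AllTypes X
  ⊆-allTypes X {x = p} p∈X j = p , p∈X , hasType-refl p j

  Below : ∀ {n} → A → Pred (Point A (suc n)) 0ℓ → Pred (Point A n) 0ℓ
  Below c X w = ∃ λ p → p ∈ X × last p ≤ c × init p ≡ w

  allTypes-init : ∀ {n c} {X : Pred (Point A (suc n)) 0ℓ} {z} → last z ≤ c →
                  AllTypes X z → AllTypes (Below c X) (init z)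
  allTypes-init z≤c Tz j with Tz (inject₁ j)
  ... | p , p∈X , p-type with hasType-inject₁⁻ j p-type
  ...   | p≤z , init-p-type = init p , (p , p∈X , ≤-trans p≤z z≤c , refl) , init-p-type

  allTypes-lift : ∀ {n} {X : Pred (Point A (suc n)) 0ℓ} {b y} → last y ≡ last b →
                  AllTypes X b → AllTypes (Below (last b) X) (init y) → AllTypes X y
  allTypes-lift {n} y≡b Tb Ty j with view j
  ... | ‵fromℕ with Tb (fromℕ (suc n))
  ...   | p , p∈X , p-type =
          p , p∈X , hasType-fromℕ (≤-cong (sym y≡b) refl (hasType-fromℕ⁻ p-type))
  allTypes-lift y≡b Tb Ty j | ‵inject₁ j′ with Ty j′
  ... | .(init p) , (p , p∈X , p≤b , refl) , init-p-type =
          p , p∈X , hasType-inject₁ j′ (≤-cong refl (sym y≡b) p≤b) init-p-type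

  allTypes-vertical : ∀ {n} {X : Pred (Point A (suc n)) 0ℓ} {a b y} →
                      init y ≗ init a → last a ≤ last y → last y ≤ last b →
                      AllTypes X a → AllTypes X b → AllTypes X y
  allTypes-vertical {n} y≗a a≤y y≤b Ta Tb j with view j
  ... | ‵fromℕ with Tb (fromℕ (suc n))
  ...   | p , p∈X , p-type = p , p∈X , hasType-fromℕ (≤-trans y≤b (hasType-fromℕ⁻ p-type))
  allTypes-vertical y≗a a≤y y≤b Ta Tb j | ‵inject₁ j′ with Ta (inject₁ j′)
  ... | p , p∈X , p-type with hasType-inject₁⁻ j′ p-type
  ...   | p≤a , init-p-type =
          p , p∈X , hasType-inject₁ j′ (≤-trans p≤a a≤y)
                                       (hasType-cong j′ (λ i → sym (y≗a i)) init-p-type)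

  mutual
    allTypes-stairConvex : ∀ d (X : Pred (Point A (suc d)) 0ℓ) → StairConvex _≤_ (AllTypes X)
    allTypes-stairConvex zero X a b Ta Tb y (inj₁ (a≤y , y≤b)) =
      allTypes-vertical (λ ()) a≤y y≤b Ta Tb
    allTypes-stairConvex zero X a b Ta Tb y (inj₂ (b≤y , y≤a)) =
      allTypes-vertical (λ ()) b≤y y≤a Tb Ta
    allTypes-stairConvex (suc d) X a b Ta Tb y (inj₁ (a≤b , up)) =
      allTypes-stairUp d X a b Ta Tb a≤b y up
    allTypes-stairConvex (suc d) X a b Ta Tb y (inj₂ (b≤a , up)) =
      allTypes-stairUp d X b a Tb Ta b≤a y up

    allTypes-stairUp : ∀ d (X : Pred (Point A (suc (suc d))) 0ℓ) a b →
                       AllTypes X a → AllTypes X b → last a ≤ last b →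
                       ∀ y → StairUp _≤_ d a b y → AllTypes X y
    allTypes-stairUp d X a b Ta Tb a≤b y (inj₁ (y≗a , a≤y , y≤b)) =
      allTypes-vertical y≗a a≤y y≤b Ta Tb
    allTypes-stairUp d X a b Ta Tb a≤b y (inj₂ (y≡b , path)) =
      allTypes-lift y≡b Tb
        (allTypes-stairConvex d (Below (last b) X) (init a) (init b)
          (allTypes-init a≤b Ta) (allTypes-init ≤-refl Tb) (init y) path)

  -- Quantifying over all extensions z of w avoids function extensionality.
  Slice : ∀ {n} → A → Pred (Point A (suc n)) 0ℓ → Pred (Point A n) 0ℓ
  Slice c S w = ∀ z → init z ≗ w → last z ≡ c → z ∈ S

  slice-stairConvex : ∀ {d c} {S : Pred (Point A (suc (suc d))) 0ℓ} →
                      StairConvex _≤_ S → StairConvex _≤_ (Slice c S)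
  slice-stairConvex {d} {c} S-convex a b a∈ b∈ y path z z≗y z≡c =
    S-convex (a ∷ʳ c) (b ∷ʳ c) (a∈ _ (init-∷ʳ a c) (last-∷ʳ a c)) (b∈ _ (init-∷ʳ b c) (last-∷ʳ b c)) z
      (inj₁ ( ≤-cong (sym (last-∷ʳ a c)) (sym (last-∷ʳ b c)) ≤-refl
            , inj₂ ( trans z≡c (sym (last-∷ʳ b c))
                   , stairPath-cong d (λ i → sym (init-∷ʳ a c i)) (λ i → sym (init-∷ʳ b c i))
                                      (λ i → sym (z≗y i)) path)))

  below⊆slice : ∀ {d c} {S X : Pred (Point A (suc (suc d))) 0ℓ} {q} →
                StairConvex _≤_ S → X ⊆ S → q ∈ X → c ≤ last q → Below c X ⊆ Slice c S
  below⊆slice {q = q} S-convex X⊆S q∈X c≤q (p , p∈X , p≤c , refl) z z≗p z≡c =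
    S-convex p q (X⊆S p∈X) (X⊆S q∈X) z
      (inj₁ ( ≤-trans p≤c c≤q
            , inj₁ (z≗p , ≤-cong refl (sym z≡c) p≤c , ≤-cong (sym z≡c) refl c≤q)))

  allTypes⊆stairConvex : ∀ d {S X : Pred (Point A (suc d)) 0ℓ} →
                         StairConvex _≤_ S → X ⊆ S → AllTypes X ⊆ S
  allTypes⊆stairConvex zero S-convex X⊆S {x} Tx with Tx zero | Tx (suc zero)
  ... | p , p∈X , p≤x | q , q∈X , (x≤q , _) =
    S-convex p q (X⊆S p∈X) (X⊆S q∈X) x (inj₁ (p≤x zero , x≤q))
  allTypes⊆stairConvex (suc d) S-convex X⊆S {x} Tx with Tx (fromℕ (suc (suc d)))
  ... | q , q∈X , q-type =
    allTypes⊆stairConvex d (slice-stairConvex S-convex)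
      (below⊆slice S-convex X⊆S q∈X (hasType-fromℕ⁻ q-type))
      (allTypes-init ≤-refl Tx) x (λ _ → refl) refl

lemma1p3 : {A : Set} (_≤_ : A → A → Set) → IsTotalOrder _≡_ _≤_ →
    (d : ℕ) (X : Pred (Point A (suc d)) 0ℓ) (x : Point A (suc d)) →
    (x ∈ sconv _≤_ X) ⇔ ((j : Fin (suc (suc d))) → ∃ λ y → y ∈ X × HasType _≤_ y x j)
lemma1p3 _≤_ total d X x = mk⇔ sound complete
  where
    open StairConvexity (IsTotalOrder.isPreorder total)

    sound : x ∈ sconv _≤_ X → x ∈ AllTypes X
    sound x∈sconv = x∈sconv (AllTypes X) (allTypes-stairConvex d X) (⊆-allTypes X)

    complete : x ∈ AllTypes X → x ∈ sconv _≤_ X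
    complete Tx S S-convex X⊆S = allTypes⊆stairConvex d S-convex X⊆S Tx
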